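{- Let $\mathcal{R}$ be a commutative ring with identity, let $p\geq 1$, $n=2^p$, and let $\omega\in\mathcal{R}$ be a principal $n$th root of unity with $\omega^{n/2}=-1$. Let $\ell\in\{2,\dotsc,n\}$, $m=\lceil\log_2\ell\rceil$, and let $a_0,\dotsc,a_{n-1}\in\mathcal{R}$ with $a_\ell=\dotsb=a_{n-1}=0$. Define $a_{k,0},\dotsc,a_{k,n-1}\in\mathcal{R}$ for $k\in\{0,\dotsc,p\}$ recursively by $a_{p,i}=a_i$ for $i\in\{0,\dotsc,n-1\}$ and, for $k<p$, \[ a_{k,2^k(2i)+j}=a_{k+1,2^k(2i)+j}+\omega^{[2i]_p}a_{k+1,2^k(2i+1)+j},\qquad a_{k,2^k(2i+1)+j}=a_{k+1,2^k(2i)+j}-\omega^{[2i]_p}a_{k+1,2^k(2i+1)+j} \] for $i\in\{0,\dotsc,2^{p-k-1}-1\}$ and $j\in\{0,\dotsc,2^k-1\}$. Then for $i\in\{0,1\}$ and $j\in\{0,\dotsc,2^{m-1}-1\}$, \[ a_{m-1,2^{m-1}i+j}=\begin{cases} a_j+(-1)^i a_{2^{m-1}+j} & \text{if } j<\ell-2^{m-1},\\ a_j & \text{if } j\geq \ell-2^{m-1}.\end{cases} \]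
   Context: An element $\omega\in\mathcal{R}$ is a principal $n$th root of unity if $\omega^n=1$ and $\sum_{j=0}^{n-1}\omega^{ij}=0$ for $i\in\{1,\dotsc,n-1\}$. For $k\in\mathbb{N}$, the $k$-bit bit-reversal permutation $[\,\cdot\,]_k$ of $\{0,\dotsc,2^k-1\}$ maps $\sum_{s=0}^{k-1}2^s i_s$ (with $i_s\in\{0,1\}$) to $\sum_{s=0}^{k-1}2^s i_{k-1-s}$. -}

module Defs where

open import Algebra.Bundles using (CommutativeRing)
open import Data.Nat using (ℕ; zero; suc; _+_; _*_; _^_; _≤_; _<_)
open import Data.Nat.DivMod using (_/_; _%_)
open import Data.Product using (_×_)

-- k-bit bit-reversal: bitrev k (Σ_{s<k} 2^s i_s) = Σ_{s<k} 2^s i_{k-1-s}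
-- (the lowest bit of x becomes bit k-1, the rest is reversed on k-1 bits)
bitrev : ℕ → ℕ → ℕ
bitrev zero    x = 0
bitrev (suc k) x = (x % 2) * 2 ^ k + bitrev k (x / 2)

module RingDefs {c r} (R : CommutativeRing c r) where
  open CommutativeRing R public
    renaming (_+_ to _+ᴿ_; _*_ to _*ᴿ_; _-_ to _-ᴿ_)

  pow : Carrier → ℕ → Carrier
  pow x zero    = 1#
  pow x (suc n) = x *ᴿ pow x n

  sumTo : ℕ → (ℕ → Carrier) → Carrier
  sumTo zero    f = 0#
  sumTo (suc n) f = sumTo n f +ᴿ f n

  IsPrincipalRoot : ℕ → Carrier → Set r
  IsPrincipalRoot n ω =
    (pow ω n ≈ 1#) × (∀ i → 1 ≤ i → i < n → sumTo n (λ j → pow ω (i * j)) ≈ 0#)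

-- The first block (i = 0) of every stage has twiddle factor ω^[0]_p = ω^0 = 1, so it is a plain
-- butterfly A k x, A k (2^k + x) = A (k+1) x ± A (k+1) (2^k + x).  As long as l ≤ 2^k, the upper
-- input A (k+1) (2^k + x) lies in the zero padding, so by descending induction from k = p the
-- stage k simply reproduces the input on [0, 2^k).  The first stage where this fails is
-- k = m - 1, and there one butterfly of two copies of the input gives the claimed formula.
-- In particular none of the hypotheses on ω are needed.
module Submission where

open import Defs
open import Algebra.Bundles using (CommutativeRing)
open import Data.Nat using (ℕ; zero; suc; _+_; _*_; _^_; _∸_; _≤_; _<_; _≤‴_; ≤‴-refl; ≤‴-step; z≤n; s≤s; ⌈_/2⌉)
open import Data.Nat.DivMod using (_/_)
open import Data.Nat.Logarithm using (⌈log₂_⌉; ⌈log₂⌉-mono-≤; ⌈log₂2^n⌉≡n)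
open import Data.Nat.Logarithm.Core using (⌈log2⌉)
open import Data.Nat.Induction using (<-wellFounded)
import Data.Nat.Properties as ℕ
open import Induction.WellFounded using (Acc; acc)
open import Data.Product using (_×_; _,_; proj₁; proj₂)
open import Relation.Nullary.Negation using (contradiction)
open import Relation.Binary.PropositionalEquality using (_≡_; refl; cong; subst)
import Algebra.Properties.Ring as RingProperties

bitrev-zero : ∀ k → bitrev k 0 ≡ 0
bitrev-zero zero    = refl
bitrev-zero (suc k) = bitrev-zero k

n≤2^⌈log2⌉n : ∀ n (rec : Acc _<_ n) → n ≤ 2 ^ ⌈log2⌉ n rec
n≤2^⌈log2⌉n zero          _        = z≤n
n≤2^⌈log2⌉n (suc zero)    _        = s≤s z≤n
n≤2^⌈log2⌉n (suc (suc n)) (acc rs) = begin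
  2 + n                             ≤⟨ ℕ.+-monoʳ-≤ 2 n≤⌈n/2⌉+⌈n/2⌉ ⟩
  2 + (⌈ n /2⌉ + ⌈ n /2⌉)           ≡⟨ cong suc (ℕ.+-suc ⌈ n /2⌉ ⌈ n /2⌉) ⟨
  suc ⌈ n /2⌉ + suc ⌈ n /2⌉         ≡⟨ cong (suc ⌈ n /2⌉ +_) (ℕ.+-identityʳ (suc ⌈ n /2⌉)) ⟨
  2 * suc ⌈ n /2⌉                   ≤⟨ ℕ.*-monoʳ-≤ 2 (n≤2^⌈log2⌉n (suc ⌈ n /2⌉) _) ⟩
  2 ^ ⌈log2⌉ (suc (suc n)) (acc rs) ∎
  where
  open ℕ.≤-Reasoning
  n≤⌈n/2⌉+⌈n/2⌉ : n ≤ ⌈ n /2⌉ + ⌈ n /2⌉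
  n≤⌈n/2⌉+⌈n/2⌉ = subst (_≤ ⌈ n /2⌉ + ⌈ n /2⌉) (ℕ.⌊n/2⌋+⌈n/2⌉≡n n)
                        (ℕ.+-monoˡ-≤ ⌈ n /2⌉ (ℕ.⌊n/2⌋≤⌈n/2⌉ n))

n≤2^⌈log₂n⌉ : ∀ n → n ≤ 2 ^ ⌈log₂ n ⌉
n≤2^⌈log₂n⌉ n = n≤2^⌈log2⌉n n (<-wellFounded n)

x<2^k⇒x<2^[1+k] : ∀ k {x} → x < 2 ^ k → x < 2 ^ suc k
x<2^k⇒x<2^[1+k] k x< = ℕ.<-≤-trans x< (ℕ.m≤m+n (2 ^ k) _)

x<2^k⇒2^k+x<2^[1+k] : ∀ k {x} → x < 2 ^ k → 2 ^ k + x < 2 ^ suc k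
x<2^k⇒2^k+x<2^[1+k] k x< = ℕ.+-monoʳ-< (2 ^ k) (ℕ.<-≤-trans x< (ℕ.m≤m+n (2 ^ k) 0))

module ZeroPaddedFFT {c r} (R : CommutativeRing c r) where
  open RingDefs R
  open RingProperties ring using (-1*x≈-x)
  open import Relation.Binary.Reasoning.Setoid setoid

  VanishesOn : ℕ → ℕ → (ℕ → Carrier) → Set r
  VanishesOn l n a = ∀ i → l ≤ i → i < n → a i ≈ 0#

  Butterflies : ℕ → Carrier → (ℕ → ℕ → Carrier) → Set r
  Butterflies p ω A = ∀ k i j → k < p → i < 2 ^ (p ∸ k ∸ 1) → j < 2 ^ k →
    (A k (2 ^ k * (2 * i) + j)
       ≈ A (suc k) (2 ^ k * (2 * i) + j)
         +ᴿ pow ω (bitrev p (2 * i)) *ᴿ A (suc k) (2 ^ k * (2 * i + 1) + j))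
    × (A k (2 ^ k * (2 * i + 1) + j)
       ≈ A (suc k) (2 ^ k * (2 * i) + j)
         -ᴿ pow ω (bitrev p (2 * i)) *ᴿ A (suc k) (2 ^ k * (2 * i + 1) + j))

  module FirstBlock {p ω} {A : ℕ → ℕ → Carrier} (butterflies : Butterflies p ω A) where

    first-block-butterfly : ∀ k x → k < p → x < 2 ^ k →
      (A k x ≈ A (suc k) x +ᴿ A (suc k) (2 ^ k + x))
      × (A k (2 ^ k + x) ≈ A (suc k) x -ᴿ A (suc k) (2 ^ k + x))
    first-block-butterfly k x k<p x<
      with butterflies k 0 x k<p (ℕ.m^n>0 2 (p ∸ k ∸ 1)) x<
    ... | sum , difference
      rewrite ℕ.*-zeroʳ (2 ^ k) | ℕ.*-identityʳ (2 ^ k) | bitrev-zero p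
      = trans sum (+-congˡ (*-identityˡ _))
      , trans difference (+-congˡ (-‿cong (*-identityˡ _)))

  module _ {p ω l} {a : ℕ → Carrier} {A : ℕ → ℕ → Carrier}
           (padding : VanishesOn l (2 ^ p) a)
           (input : ∀ i → i < 2 ^ p → A p i ≈ a i)
           (butterflies : Butterflies p ω A) where

    open FirstBlock {A = A} butterflies

    stage-agrees-with-input : ∀ {k} → k ≤‴ p → l ≤ 2 ^ k → ∀ x → x < 2 ^ k → A k x ≈ a x
    stage-agrees-with-input ≤‴-refl _ = input
    stage-agrees-with-input {k} (≤‴-step k<‴p) l≤2^k x x< = begin
      A k x                                 ≈⟨ proj₁ (first-block-butterfly k x k<p x<) ⟩
      A (suc k) x +ᴿ A (suc k) (2 ^ k + x)  ≈⟨ +-cong (previous x (x<2^k⇒x<2^[1+k] k x<))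
                                                       (previous (2 ^ k + x) 2^k+x<) ⟩
      a x +ᴿ a (2 ^ k + x)                  ≈⟨ +-congˡ (padding (2 ^ k + x) l≤2^k+x
                                                  (ℕ.<-≤-trans 2^k+x< (ℕ.^-monoʳ-≤ 2 k<p))) ⟩
      a x +ᴿ 0#                             ≈⟨ +-identityʳ (a x) ⟩
      a x                                   ∎
      where
      k<p : k < p
      k<p = ℕ.≤‴⇒≤ k<‴p
      2^k+x< : 2 ^ k + x < 2 ^ suc k
      2^k+x< = x<2^k⇒2^k+x<2^[1+k] k x<
      l≤2^k+x : l ≤ 2 ^ k + x
      l≤2^k+x = ℕ.≤-trans l≤2^k (ℕ.m≤m+n (2 ^ k) x)
      previous : ∀ y → y < 2 ^ suc k → A (suc k) y ≈ a y
      previous = stage-agrees-with-input k<‴p (ℕ.≤-trans l≤2^k (ℕ.m≤m+n (2 ^ k) _))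

    last-stage : ∀ k → k < p → l ≤ 2 ^ suc k → ∀ i j → i < 2 → j < 2 ^ k →
      A k (2 ^ k * i + j) ≈ a j +ᴿ pow (- 1#) i *ᴿ a (2 ^ k + j)
    last-stage k k<p l≤2^[1+k] 0 j _ j< = begin
      A k (2 ^ k * 0 + j)                   ≡⟨ cong (λ y → A k (y + j)) (ℕ.*-zeroʳ (2 ^ k)) ⟩
      A k j                                 ≈⟨ proj₁ (first-block-butterfly k j k<p j<) ⟩
      A (suc k) j +ᴿ A (suc k) (2 ^ k + j)  ≈⟨ +-cong (next-is-input j (x<2^k⇒x<2^[1+k] k j<))
                                                       (next-is-input (2 ^ k + j) (x<2^k⇒2^k+x<2^[1+k] k j<)) ⟩
      a j +ᴿ a (2 ^ k + j)                  ≈⟨ +-congˡ (*-identityˡ _) ⟨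
      a j +ᴿ 1# *ᴿ a (2 ^ k + j)            ∎
      where
      next-is-input : ∀ y → y < 2 ^ suc k → A (suc k) y ≈ a y
      next-is-input = stage-agrees-with-input (ℕ.≤⇒≤‴ k<p) l≤2^[1+k]
    last-stage k k<p l≤2^[1+k] 1 j _ j< = begin
      A k (2 ^ k * 1 + j)                   ≡⟨ cong (λ y → A k (y + j)) (ℕ.*-identityʳ (2 ^ k)) ⟩
      A k (2 ^ k + j)                       ≈⟨ proj₂ (first-block-butterfly k j k<p j<) ⟩
      A (suc k) j -ᴿ A (suc k) (2 ^ k + j)  ≈⟨ +-cong (next-is-input j (x<2^k⇒x<2^[1+k] k j<))
                                                       (-‿cong (next-is-input (2 ^ k + j) (x<2^k⇒2^k+x<2^[1+k] k j<))) ⟩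
      a j -ᴿ a (2 ^ k + j)                  ≈⟨ +-congˡ (-1*x≈-x _) ⟨
      a j +ᴿ - 1# *ᴿ a (2 ^ k + j)          ≈⟨ +-congˡ (*-congʳ (*-identityʳ (- 1#))) ⟨
      a j +ᴿ (- 1# *ᴿ 1#) *ᴿ a (2 ^ k + j)  ∎
      where
      next-is-input : ∀ y → y < 2 ^ suc k → A (suc k) y ≈ a y
      next-is-input = stage-agrees-with-input (ℕ.≤⇒≤‴ k<p) l≤2^[1+k]
    last-stage k _ _ (suc (suc _)) _ (s≤s (s≤s ())) _

    zero-padded-fft : 2 ≤ l → ∀ m → m ≤ p → l ≤ 2 ^ m → ∀ i j → i < 2 → j < 2 ^ (m ∸ 1) →
      (j < l ∸ 2 ^ (m ∸ 1) →
         A (m ∸ 1) (2 ^ (m ∸ 1) * i + j) ≈ a j +ᴿ pow (- 1#) i *ᴿ a (2 ^ (m ∸ 1) + j))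
      × (l ∸ 2 ^ (m ∸ 1) ≤ j →
         A (m ∸ 1) (2 ^ (m ∸ 1) * i + j) ≈ a j)
    zero-padded-fft 2≤l zero _ l≤1 = contradiction (ℕ.≤-trans 2≤l l≤1) λ { (s≤s ()) }
    zero-padded-fft _ (suc k) m≤p l≤2^m i j i<2 j< = (λ _ → butterfly) , λ l∸2^k≤j → begin
      A k (2 ^ k * i + j)                   ≈⟨ butterfly ⟩
      a j +ᴿ pow (- 1#) i *ᴿ a (2 ^ k + j)  ≈⟨ +-congˡ (*-congˡ (padding (2 ^ k + j) (l≤2^k+j l∸2^k≤j) 2^k+j<2^p)) ⟩
      a j +ᴿ pow (- 1#) i *ᴿ 0#             ≈⟨ +-congˡ (zeroʳ _) ⟩
      a j +ᴿ 0#                             ≈⟨ +-identityʳ (a j) ⟩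
      a j                                   ∎
      where
      butterfly : A k (2 ^ k * i + j) ≈ a j +ᴿ pow (- 1#) i *ᴿ a (2 ^ k + j)
      butterfly = last-stage k m≤p l≤2^m i j i<2 j<
      l≤2^k+j : l ∸ 2 ^ k ≤ j → l ≤ 2 ^ k + j
      l≤2^k+j l∸2^k≤j = ℕ.≤-trans (ℕ.m≤n+m∸n l (2 ^ k)) (ℕ.+-monoʳ-≤ (2 ^ k) l∸2^k≤j)
      2^k+j<2^p : 2 ^ k + j < 2 ^ p
      2^k+j<2^p = ℕ.<-≤-trans (x<2^k⇒2^k+x<2^[1+k] k j<) (ℕ.^-monoʳ-≤ 2 m≤p)

lemma2p3 : ∀ {c r} (R : CommutativeRing c r) →
    let open RingDefs R in (p : ℕ) → 1 ≤ p →
       (ω : Carrier) → IsPrincipalRoot (2 ^ p) ω → pow ω (2 ^ p / 2) ≈ - 1# →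
       (l : ℕ) → 2 ≤ l → l ≤ 2 ^ p →
       (a : ℕ → Carrier) → (∀ i → l ≤ i → i < 2 ^ p → a i ≈ 0#) →
       (A : ℕ → ℕ → Carrier) →
       (∀ i → i < 2 ^ p → A p i ≈ a i) →
       (∀ k i j → k < p → i < 2 ^ (p ∸ k ∸ 1) → j < 2 ^ k →
          (A k (2 ^ k * (2 * i) + j)
             ≈ A (suc k) (2 ^ k * (2 * i) + j)
               +ᴿ pow ω (bitrev p (2 * i)) *ᴿ A (suc k) (2 ^ k * (2 * i + 1) + j))
          × (A k (2 ^ k * (2 * i + 1) + j)
             ≈ A (suc k) (2 ^ k * (2 * i) + j)
               -ᴿ pow ω (bitrev p (2 * i)) *ᴿ A (suc k) (2 ^ k * (2 * i + 1) + j))) →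
       let m = ⌈log₂ l ⌉
       in ∀ i j → i < 2 → j < 2 ^ (m ∸ 1) →
          (j < l ∸ 2 ^ (m ∸ 1) →
             A (m ∸ 1) (2 ^ (m ∸ 1) * i + j) ≈ a j +ᴿ pow (- 1#) i *ᴿ a (2 ^ (m ∸ 1) + j))
          × (l ∸ 2 ^ (m ∸ 1) ≤ j →
             A (m ∸ 1) (2 ^ (m ∸ 1) * i + j) ≈ a j)
lemma2p3 R p _ _ _ _ l 2≤l l≤2^p a padding A input butterflies =
  ZeroPaddedFFT.zero-padded-fft R {A = A} padding input butterflies 2≤l ⌈log₂ l ⌉ m≤p (n≤2^⌈log₂n⌉ l)
  where
  m≤p : ⌈log₂ l ⌉ ≤ p
  m≤p = subst (⌈log₂ l ⌉ ≤_) (⌈log₂2^n⌉≡n p) (⌈log₂⌉-mono-≤ l≤2^p)
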